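{- Let $\mathcal{X}$ be a program over the memory access alphabet, and suppose that for each partial string $x \in \mathcal{X}$ a read-from function $\mathsf{rf}_x$ is given, assigning to each acquire $l \in E_x$ on a location $a$ a release $\mathsf{rf}_x(l) \in E_x$ on the same location $a$. Then the following are equivalent: (i) $\mathcal{X}$ is SC-relaxed and, for every $x \in \mathcal{X}$ and every acquire $l \in E_x$, $\mathsf{rf}_x(l) = \bigvee \mathcal{H}_x(l)$; (ii) for every $x \in \mathcal{X}$ the following three axioms hold with respect to release/acquire events: (synchronizes-with) for every acquire $l$, $\mathsf{rf}_x(l) \preceq_x l$; (write-coherence) for every location $a$, any two releases on $a$ are comparable under $\preceq_x$; (from-read) for every acquire $l$ and releases $s, s'$ on the same location, if $\mathsf{rf}_x(l) = s$ and $s \prec_x s'$ then $l \preceq_x s'$.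
   Context: A partial string is a triple $x = (E_x, \alpha_x, \preceq_x)$ with $E_x$ a set of events, $\alpha_x$ a labelling of events by letters of an alphabet, and $\preceq_x$ a partial order on $E_x$; $\mathsf{P}_f$ is the set of finite partial strings. For $y,x$ partial strings, $y \sqsubseteq x$ means there is a bijection $f\colon E_x \to E_y$ preserving labels with $e \preceq_x e' \Rightarrow f(e) \preceq_y f(e')$. A program is a set $\mathcal{X} \subseteq \mathsf{P}_f$ closed downward under $\sqsubseteq$. Memory access alphabet: fix disjoint sets of memory locations and registers. Labels are load labels $(t, r, a)$ with $t \in \{\mathsf{none}, \mathsf{acquire}\}$, $r$ a register, $a$ a location, and store labels $(t, a, b)$ with $t \in \{\mathsf{none}, \mathsf{release}\}$, $a$ a location, $b \in \{0,1\}$. An event labelled $(\mathsf{acquire}, r, a)$ is an acquire on $a$; an event labelled $(\mathsf{release}, a, b)$ is a release on $a$. A program $\mathcal{X}$ is SC-relaxed if for every location $a$ and every $x \in \mathcal{X}$, the release events on $a$ are totally ordered by $\preceq_x$, and for every acquire $l$ and release $s$ on $a$ in $E_x$, $l \preceq_x s$ or $s \preceq_x l$. For an acquire $l$ on $a$ in $E_x$, $\mathcal{H}_x(l) = \{s \in E_x : s \preceq_x l,\ s \text{ a release on } a\}$ and $\bigvee \mathcal{H}_x(l)$ denotes its least upper bound in $(E_x, \preceq_x)$ (with $\bigvee\emptyset$ a formal element $\bot$, never equal to an event). $s \prec_x s'$ means $s \preceq_x s'$ and $s \neq s'$. -}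

module Defs where

open import Data.Nat using (ℕ)
open import Data.Fin using (Fin)
open import Data.Bool using (Bool)
open import Data.Product using (Σ; ∃; ∃-syntax; _×_)
open import Data.Sum using (_⊎_)
open import Relation.Binary.PropositionalEquality using (_≡_)
open import Relation.Binary.Structures using (IsPartialOrder)
open import Relation.Nullary using (¬_)
open import Function.Definitions using (Bijective)

record PartialString (A : Set) : Set₁ where
  field
    size    : ℕ
    α       : Fin size → A
    _≼_     : Fin size → Fin size → Set
    isPO    : IsPartialOrder _≡_ _≼_

open PartialString public

E : {A : Set} → PartialString A → Set
E x = Fin (size x)

_⊑_ : {A : Set} → PartialString A → PartialString A → Set
_⊑_ {A} y x = Σ (E x → E y) λ f →
    Bijective _≡_ _≡_ f
  × (∀ e → α y (f e) ≡ α x e)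
  × (∀ e e' → _≼_ x e e' → _≼_ y (f e) (f e'))

record Program (A : Set) : Set₂ where
  field
    _∈X_     : PartialString A → Set
    downward : ∀ x y → _∈X_ x → y ⊑ x → _∈X_ y

open Program public

data LoadType : Set where
  none acquire : LoadType

data StoreType : Set where
  none release : StoreType

data Label (Loc Reg : Set) : Set where
  load  : LoadType  → Reg → Loc → Label Loc Reg
  store : StoreType → Loc → Bool → Label Loc Reg

module MemoryAccess (Loc Reg : Set) where

  PS : Set₁
  PS = PartialString (Label Loc Reg)

  IsAcquireOn : (x : PS) → E x → Loc → Set
  IsAcquireOn x l a = ∃[ r ] (α x l ≡ load acquire r a)

  IsReleaseOn : (x : PS) → E x → Loc → Set
  IsReleaseOn x s a = ∃[ b ] (α x s ≡ store release a b)

  Strict : (x : PS) → E x → E x → Set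
  Strict x s s' = _≼_ x s s' × ¬ (s ≡ s')

  InH : (x : PS) → Loc → E x → E x → Set
  InH x a l s = _≼_ x s l × IsReleaseOn x s a

  IsLUB : (x : PS) → (E x → Set) → E x → Set
  IsLUB x S e = (∀ s → S s → _≼_ x s e)
              × (∀ u → (∀ s → S s → _≼_ x s u) → _≼_ x e u)

  -- e = ⋁ H_x(l)  (⋁ ∅ = ⊥ is never an event, so H must be nonempty)
  IsJoinOfH : (x : PS) → Loc → E x → E x → Set
  IsJoinOfH x a l e = (∃[ s ] InH x a l s) × IsLUB x (InH x a l) e

  SCRelaxed : Program (Label Loc Reg) → Set₁
  SCRelaxed X = ∀ (a : Loc) (x : PS) → (X ∈X x) →
      (∀ s s' → IsReleaseOn x s a → IsReleaseOn x s' a →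
         _≼_ x s s' ⊎ _≼_ x s' s)
    × (∀ l s → IsAcquireOn x l a → IsReleaseOn x s a →
         _≼_ x l s ⊎ _≼_ x s l)

  ReadFrom : Program (Label Loc Reg) → Set₁
  ReadFrom X = (x : PS) → X ∈X x → E x → E x

  RFWellFormed : (X : Program (Label Loc Reg)) → ReadFrom X → Set₁
  RFWellFormed X rf = ∀ (x : PS) (p : X ∈X x) (l : E x) (a : Loc) →
    IsAcquireOn x l a → IsReleaseOn x (rf x p l) a

  ConditionI : (X : Program (Label Loc Reg)) → ReadFrom X → Set₁
  ConditionI X rf = SCRelaxed X
    × (∀ (x : PS) (p : X ∈X x) (l : E x) (a : Loc) →
         IsAcquireOn x l a → IsJoinOfH x a l (rf x p l))

  ConditionII : (X : Program (Label Loc Reg)) → ReadFrom X → Set₁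
  ConditionII X rf = ∀ (x : PS) (p : X ∈X x) →
      (∀ l a → IsAcquireOn x l a → _≼_ x (rf x p l) l)
    × (∀ a s s' → IsReleaseOn x s a → IsReleaseOn x s' a →
         _≼_ x s s' ⊎ _≼_ x s' s)
    × (∀ l a s s' → IsAcquireOn x l a → IsReleaseOn x s a →
         IsReleaseOn x s' a → rf x p l ≡ s → Strict x s s' → _≼_ x l s')

module Submission where

-- Everything happens inside one partial string x, for one
-- acquire l on a location a and the release r = rf x l it reads from.
-- Write-coherence is literally the first half of SC-relaxedness, so the
-- equivalence reduces to two local facts about l and r:
--
--   * if r = ⋁ H(l) then r ≼ l (l bounds H(l) from above), and, provided
--     l is comparable with every release on a, no release s' with
--     r ≺ s' can lie below l (it would be in H(l), hence ≼ r), so l ≼ s';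
--   * conversely, from r ≼ l, write-coherence and from-read, l is
--     comparable with every release s on a (compare s with r), and r is
--     the greatest element of H(l), hence its join.

open import Defs
open import Function.Bundles using (_⇔_; mk⇔)
open import Data.Product using (_,_; proj₁; proj₂)
open import Data.Sum using (inj₁; inj₂; _⊎_)
open import Data.Fin.Properties using (_≟_)
open import Relation.Nullary using (¬_; yes; no; contradiction)
open import Relation.Binary.PropositionalEquality using (_≡_; refl; sym; trans; subst)
open import Relation.Binary.Structures using (IsPartialOrder)

module _ (Loc Reg : Set) where
  open MemoryAccess Loc Reg

  acquire-not-release : (x : PS) {e : E x} {a b : Loc} →
                        IsAcquireOn x e a → ¬ IsReleaseOn x e b
  acquire-not-release x (r , isLoad) (v , isStore) with trans (sym isLoad) isStore
  ... | ()

  module LocalFacts (x : PS) where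
    open IsPartialOrder (isPO x) using (reflexive; antisym) renaming (trans to ≼-trans)

    ≼⇒≡⊎≺ : ∀ {s s'} → _≼_ x s s' → s ≡ s' ⊎ Strict x s s'
    ≼⇒≡⊎≺ {s} {s'} s≼s' with s ≟ s'
    ... | yes s≡s' = inj₁ s≡s'
    ... | no  s≢s' = inj₂ (s≼s' , s≢s')

    module _ {l r : E x} {a : Loc} (acq : IsAcquireOn x l a) where

      -- Synchronizes-with from (i): l is an upper bound of H(l), and
      -- the join lies below every upper bound.
      join⇒sw : IsJoinOfH x a l r → _≼_ x r l
      join⇒sw (_ , _ , least) = least l (λ s inH → proj₁ inH)

      -- From-read from (i): a release s' above r cannot be below l, since
      -- it would then lie in H(l), hence below r, contradicting r ≺ s'.
      join⇒fr : (∀ s → IsReleaseOn x s a → _≼_ x l s ⊎ _≼_ x s l) →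
                IsJoinOfH x a l r →
                ∀ s' → IsReleaseOn x s' a → Strict x r s' → _≼_ x l s'
      join⇒fr comparable (_ , upper , _) s' rel' (r≼s' , r≢s')
        with comparable s' rel'
      ... | inj₁ l≼s' = l≼s'
      ... | inj₂ s'≼l = contradiction (antisym r≼s' (upper s' (s'≼l , rel'))) r≢s'

      module _ (rel : IsReleaseOn x r a) (sw : _≼_ x r l)
               (wc : ∀ s → IsReleaseOn x s a → _≼_ x r s ⊎ _≼_ x s r)
               (fr : ∀ s' → IsReleaseOn x s' a → Strict x r s' → _≼_ x l s')
               where

        -- Every release on a is comparable with l: either it is below r
        -- (hence below l), equal to r, or strictly above r (hence above l).
        fr⇒comparable : ∀ s → IsReleaseOn x s a → _≼_ x l s ⊎ _≼_ x s l
        fr⇒comparable s rel-s with wc s rel-s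
        ... | inj₂ s≼r = inj₂ (≼-trans s≼r sw)
        ... | inj₁ r≼s with ≼⇒≡⊎≺ r≼s
        ...   | inj₁ refl = inj₂ sw
        ...   | inj₂ r≺s  = inj₁ (fr s rel-s r≺s)

        -- r is the greatest element of H(l): a release of H(l) strictly
        -- above r would be both below and above the acquire l, making l
        -- a release.
        fr⇒join : IsJoinOfH x a l r
        fr⇒join = (r , sw , rel) , upper , (λ _ bounds → bounds r (sw , rel))
          where
          upper : ∀ s → InH x a l s → _≼_ x s r
          upper s (s≼l , rel-s) with wc s rel-s
          ... | inj₂ s≼r = s≼r
          ... | inj₁ r≼s with ≼⇒≡⊎≺ r≼s
          ...   | inj₁ refl = reflexive refl
          ...   | inj₂ r≺s  = contradiction
                  (subst (λ e → IsReleaseOn x e a) (antisym s≼l (fr s rel-s r≺s)) rel-s)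
                  (acquire-not-release x acq)

  module _ (X : Program (Label Loc Reg)) (rf : ReadFrom X) where

    i⇒ii : ConditionI X rf → ConditionII X rf
    i⇒ii (sc , join) x p =
        (λ l a acq → join⇒sw acq (join x p l a acq))
      , (λ a → proj₁ (sc a x p))
      , (λ { l a s s' acq _ rel' refl r≺s' →
               join⇒fr acq (λ s rel → proj₂ (sc a x p) l s acq rel)
                       (join x p l a acq) s' rel' r≺s' })
      where open LocalFacts x

    ii⇒i : RFWellFormed X rf → ConditionII X rf → ConditionI X rf
    ii⇒i wf cond = sc , join
      where
      module Local (x : PS) (p : X ∈X x) (l : E x) (a : Loc) (acq : IsAcquireOn x l a) where
        open LocalFacts x
        r : E x
        r = rf x p l

        rel : IsReleaseOn x r a
        rel = wf x p l a acq

        sw : _≼_ x r l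
        sw = proj₁ (cond x p) l a acq

        wc : ∀ s → IsReleaseOn x s a → _≼_ x r s ⊎ _≼_ x s r
        wc s rel-s = proj₁ (proj₂ (cond x p)) a r s rel rel-s

        fr : ∀ s' → IsReleaseOn x s' a → Strict x r s' → _≼_ x l s'
        fr s' rel' = proj₂ (proj₂ (cond x p)) l a r s' acq rel rel' refl

        comparable : ∀ s → IsReleaseOn x s a → _≼_ x l s ⊎ _≼_ x s l
        comparable = fr⇒comparable acq rel sw wc fr

        isJoin : IsJoinOfH x a l r
        isJoin = fr⇒join acq rel sw wc fr

      sc : SCRelaxed X
      sc a x p = proj₁ (proj₂ (cond x p)) a
               , (λ l s acq rel-s → Local.comparable x p l a acq s rel-s)

      join : ∀ (x : PS) (p : X ∈X x) (l : E x) (a : Loc) →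
             IsAcquireOn x l a → IsJoinOfH x a l (rf x p l)
      join = Local.isJoin

theorem3 : (Loc Reg : Set) → let open MemoryAccess Loc Reg in
    (X : Program (Label Loc Reg)) (rf : ReadFrom X) →
    RFWellFormed X rf →
    ConditionI X rf ⇔ ConditionII X rf
theorem3 Loc Reg X rf wf = mk⇔ (i⇒ii Loc Reg X rf) (ii⇒i Loc Reg X rf wf)
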